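{- For every $n\in\mathbb{N}$ the graph $G(3,5,n)$ has a Hamiltonian path, and for every even $n>2$ the graph $G(3,5,n)$ is Hamiltonian (has a Hamiltonian cycle).
   Context: For a prime $p$ and $n\in\mathbb{N}$, $G(p,n)$ is the simple graph with vertex set $\{2,4,\ldots,2n\}$ in which two distinct vertices $a,b$ are adjacent if and only if both $\frac{a+b}{2}$ and $\frac{|a-b|}{2}$ are odd positive integers neither of which equals $pk$ for an integer $k\ge 2$. $G(3,5,n)$ is the intersection of $G(3,n)$ and $G(5,n)$: the graph on $\{2,4,\ldots,2n\}$ whose edge set is the intersection of their edge sets. -}

module Defs where

open import Data.Nat using (ℕ; suc; _+_; _*_; _≤_; _<_; ∣_-_∣)
open import Data.Nat.DivMod using (_/_; _%_)
open import Data.List using (List; []; _∷_; map; upTo; _++_; [_])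
open import Data.List.Relation.Binary.Permutation.Propositional using (_↭_)
open import Data.List.Relation.Unary.Linked using (Linked)
open import Data.List.Membership.Propositional using (_∈_)
open import Data.Product using (_×_; ∃; ∃-syntax)
open import Relation.Nullary using (¬_)
open import Relation.Binary.PropositionalEquality using (_≡_; _≢_)

record Graph : Set₁ where
  field
    V   : List ℕ
    Adj : ℕ → ℕ → Set

Admissible : ℕ → ℕ → Set
Admissible p x = x % 2 ≡ 1 × 0 < x × ¬ (∃[ k ] (2 ≤ k × x ≡ p * k))

evens : ℕ → List ℕ
evens n = map (λ i → 2 * suc i) (upTo n)

G : ℕ → ℕ → Graph
G p n = record
  { V   = evens n
  ; Adj = λ a b → a ∈ evens n × b ∈ evens n × a ≢ b
                  × Admissible p ((a + b) / 2) × Admissible p (∣ a - b ∣ / 2) }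

_∩G_ : Graph → Graph → Graph
G₁ ∩G G₂ = record
  { V   = Graph.V G₁
  ; Adj = λ a b → Graph.Adj G₁ a b × Graph.Adj G₂ a b }

G35 : ℕ → Graph
G35 n = G 3 n ∩G G 5 n

HamiltonianPath : Graph → Set
HamiltonianPath g = ∃[ vs ] (vs ↭ Graph.V g × Linked (Graph.Adj g) vs)

Hamiltonian : Graph → Set
Hamiltonian g = ∃[ v ] ∃[ vs ] ((v ∷ vs) ↭ Graph.V g
                              × Linked (Graph.Adj g) (v ∷ vs ++ [ v ]))

-- Write the vertex 2(i+1) as i.  Call an edge {i, j} of G(3,5,n) stable if moreover i+j+2 is coprime
-- to 30; translating both ends by 15 adds 30 to i+j+2 and keeps |i-j|, so stable edges stay stable.
-- Hence a stable Hamiltonian path of {0, …, n-1} from 0 to 1 (n even) or to 2 (n odd), translated by 15,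
-- can be spliced into one of two fixed stable paths through {0, …, 14}, giving such a path of
-- {0, …, n+14}.  Explicit paths for 8 ≤ n < 23 start this induction; explicit paths settle n < 8.
-- For even n ≥ 8 the path ends at 1, which is adjacent to 0, so it closes into a Hamiltonian cycle;
-- n = 4 and n = 6 are settled by explicit cycles.

module Submission where

open import Defs
open import Data.Nat
  using (ℕ; zero; suc; z≤n; s≤s; z<s; _+_; _*_; _∸_; _%_; _/_; ∣_-_∣; _≤_; _<_; NonZero; _≟_; _≤?_; _<?_)
open import Data.Nat.Properties
  using ( ≤-decTotalOrder; *-comm; *-cancelʳ-≡; *-cancelˡ-≡; suc-injective; <⇒≢; n≢0⇒n>0; m≡n⇒∣m-n∣≡0
        ; *-distribˡ-∣-∣; ≮⇒≥; ∸-monoˡ-≤; ∸-monoʳ-<; m+[n∸m]≡n; *-monoʳ-≤; +-comm; +-identityʳ; allUpTo?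
        ; ≤-trans; m≤m+n )
open import Data.Nat.DivMod using (m*n/n≡m)
open import Data.Nat.Divisibility using (_∣_; _∤_; divides; _∣?_; _∣0; ∣-refl; ∣m∣n⇒∣m+n; ∣m+n∣m⇒∣n)
open import Data.Nat.Coprimality using (Coprime; coprime?)
open import Data.Nat.Induction using (<-rec)
open import Data.Nat.Solver using (module +-*-Solver)
open import Data.List using (List; []; _∷_; _++_; [_]; map; upTo; applyUpTo)
open import Data.List.Properties using (map-upTo; map-++; ++-assoc; ≡-dec)
open import Data.List.Membership.Propositional using (_∈_)
open import Data.List.Membership.Propositional.Properties using (∈-map⁺)
open import Data.List.Relation.Unary.All using (All; []; _∷_)
import Data.List.Relation.Unary.All as All
open import Data.List.Relation.Unary.All.Properties using () renaming (++⁺ to All-++⁺)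
open import Data.List.Relation.Unary.Linked using (Linked; []; [-]; _∷_; linked?)
open import Data.List.Relation.Binary.Permutation.Propositional
  using (_↭_; ↭-refl; ↭-sym; ↭-trans; module PermutationReasoning)
open import Data.List.Relation.Binary.Permutation.Propositional.Properties
  using (++⁺; ++⁺ˡ; ++-comm; ∈-resp-↭) renaming (map⁺ to ↭-map⁺)
open import Data.List.Sort.InsertionSort ≤-decTotalOrder using (sort)
open import Data.List.Sort.InsertionSort.Properties ≤-decTotalOrder using (sort-↭)
open import Data.Product using (_×_; _,_; ∃-syntax; uncurry)
open import Function using (_∘_)
open import Level using (Level; _⊔_; 0ℓ)
open import Relation.Binary using (Rel; _⇒_; DecidableEquality) renaming (Decidable to Decidable₂)
open import Relation.Unary using (Pred; Decidable)
open import Relation.Nullary using (Dec; yes; no; ¬?; contradiction)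
open import Relation.Nullary.Decidable using (_×-dec_; _→-dec_; map′; from-yes)
open import Relation.Binary.PropositionalEquality
  using (_≡_; _≢_; refl; sym; trans; cong; subst; module ≡-Reasoning)

private
  variable
    a b ℓ ℓ′ ℓ″ : Level
    A : Set a
    B : Set b

properMultiple? : ∀ p .{{_ : NonZero p}} s → Dec (∃[ k ] (2 ≤ k × s ≡ p * k))
properMultiple? p s with p ∣? s
... | no p∤s = no λ (k , _ , s≡pk) → p∤s (divides k (trans s≡pk (*-comm p k)))
... | yes (divides q s≡qp) with 2 ≤? q
...   | yes 2≤q = yes (q , 2≤q , trans s≡qp (*-comm q p))
...   | no 2≰q  = no λ (k , 2≤k , s≡pk) →
          2≰q (subst (2 ≤_) (*-cancelʳ-≡ k q p (trans (*-comm k p) (trans (sym s≡pk) s≡qp))) 2≤k)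

admissible? : ∀ p .{{_ : NonZero p}} → Decidable (Admissible p)
admissible? p s = s % 2 ≟ 1 ×-dec 0 <? s ×-dec ¬? (properMultiple? p s)

2∤⇒odd : ∀ s → 2 ∤ s → s % 2 ≡ 1
2∤⇒odd zero          2∤s = contradiction (2 ∣0) 2∤s
2∤⇒odd (suc zero)    _   = refl
2∤⇒odd (suc (suc s)) 2∤s = 2∤⇒odd s (2∤s ∘ ∣m∣n⇒∣m+n ∣-refl)

coprime⇒∤ : ∀ {d m s} → 1 < d → d ∣ m → Coprime s m → d ∤ s
coprime⇒∤ 1<d d∣m coprime d∣s = <⇒≢ 1<d (sym (coprime (d∣s , d∣m)))

coprime⇒admissible : ∀ p {m s} → 1 < p → p ∣ m → 2 ∣ m → Coprime s m → Admissible p s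
coprime⇒admissible p {s = s} 1<p p∣m 2∣m coprime =
    2∤⇒odd s (coprime⇒∤ (s≤s (s≤s z≤n)) 2∣m coprime)
  , n≢0⇒n>0 (λ { refl → p∤s (p ∣0) })
  , λ (k , _ , s≡pk) → p∤s (divides k (trans s≡pk (*-comm p k)))
  where
  p∤s : p ∤ s
  p∤s = coprime⇒∤ 1<p p∣m coprime

Admissible₃₅ : Pred ℕ 0ℓ
Admissible₃₅ s = Admissible 3 s × Admissible 5 s

admissible₃₅? : Decidable Admissible₃₅
admissible₃₅? s = admissible? 3 s ×-dec admissible? 5 s

-- For a = 2(i+1) and b = 2(j+1): (a+b)/2 = i+j+2 and |a-b|/2 = |i-j|.
record Adjacent (i j : ℕ) : Set where
  constructor adjacent
  field
    half-sum  : Admissible₃₅ (2 + i + j)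
    half-diff : Admissible₃₅ ∣ i - j ∣

-- Unlike Adjacent, Stable is invariant under translation by 15, which changes the half-sum by 30.
record Stable (i j : ℕ) : Set where
  constructor stable
  field
    half-sum  : Coprime (2 + i + j) 30
    half-diff : Admissible₃₅ ∣ i - j ∣

adjacent? : Decidable₂ Adjacent
adjacent? i j = map′ (uncurry adjacent) (λ (adjacent s d) → s , d)
  (admissible₃₅? (2 + i + j) ×-dec admissible₃₅? ∣ i - j ∣)

stable? : Decidable₂ Stable
stable? i j = map′ (uncurry stable) (λ (stable s d) → s , d)
  (coprime? (2 + i + j) 30 ×-dec admissible₃₅? ∣ i - j ∣)

stable⇒adjacent : Stable ⇒ Adjacent
stable⇒adjacent (stable coprime d) = adjacent
  ( coprime⇒admissible 3 (s≤s (s≤s z≤n)) (divides 10 refl) (divides 15 refl) coprime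
  , coprime⇒admissible 5 (s≤s (s≤s z≤n)) (divides 6 refl) (divides 15 refl) coprime )
  d

coprime-+ : ∀ {s m} → Coprime s m → Coprime (s + m) m
coprime-+ {s} {m} coprime {d} (d∣s+m , d∣m) =
  coprime (∣m+n∣m⇒∣n (subst (d ∣_) (+-comm s m) d∣s+m) d∣m , d∣m)

stable-translate : ∀ {i j} → Stable i j → Stable (15 + i) (15 + j)
stable-translate {i} {j} (stable coprime d) =
  stable (subst (λ s → Coprime s 30) (sym (half-sum i j)) (coprime-+ coprime)) d
  where
  open +-*-Solver
  half-sum : ∀ i j → 2 + (15 + i) + (15 + j) ≡ 2 + i + j + 30
  half-sum = solve 2 (λ i j → con 2 :+ (con 15 :+ i) :+ (con 15 :+ j) := con 2 :+ i :+ j :+ con 30) refl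

-- xs lists the vertices after x.
data Path {A : Set a} (R : Rel A ℓ) : A → A → List A → Set (a ⊔ ℓ) where
  []  : ∀ {x} → Path R x x []
  _∷_ : ∀ {x y z ys} → R x y → Path R y z ys → Path R x z (y ∷ ys)

module _ {R : Rel A ℓ} where

  path-++ : ∀ {x y z xs ys} → Path R x y xs → Path R y z ys → Path R x z (xs ++ ys)
  path-++ []      q = q
  path-++ (r ∷ p) q = r ∷ path-++ p q

  path⇒linked : ∀ {x y xs} → Path R x y xs → Linked R (x ∷ xs)
  path⇒linked []            = [-]
  path⇒linked (r ∷ [])      = r ∷ [-]
  path⇒linked (r ∷ r′ ∷ p)  = r ∷ path⇒linked (r′ ∷ p)

  path-mono : ∀ {S : Rel A ℓ′} → R ⇒ S → ∀ {x y xs} → Path R x y xs → Path S x y xs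
  path-mono R⇒S []      = []
  path-mono R⇒S (r ∷ p) = R⇒S r ∷ path-mono R⇒S p

  path-map : ∀ {S : Rel B ℓ′} (f : A → B) → (∀ {x y} → R x y → S (f x) (f y)) →
             ∀ {x y xs} → Path R x y xs → Path S (f x) (f y) (map f xs)
  path-map f pres []      = []
  path-map f pres (r ∷ p) = pres r ∷ path-map f pres p

  path? : DecidableEquality A → Decidable₂ R → ∀ x y xs → Dec (Path R x y xs)
  path? _≟_ R? x y []       = map′ (λ { refl → [] }) (λ { [] → refl }) (x ≟ y)
  path? _≟_ R? x y (z ∷ zs) =
    map′ (uncurry _∷_) (λ { (r ∷ p) → r , p }) (R? x z ×-dec path? _≟_ R? z y zs)

applyUpTo-+ : ∀ (f : ℕ → A) m n → applyUpTo f (m + n) ≡ applyUpTo f m ++ applyUpTo (f ∘ (m +_)) n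
applyUpTo-+ f zero    n = refl
applyUpTo-+ f (suc m) n = cong (f 0 ∷_) (applyUpTo-+ (f ∘ suc) m n)

upTo-+ : ∀ m n → upTo (m + n) ≡ upTo m ++ map (m +_) (upTo n)
upTo-+ m n = trans (applyUpTo-+ (λ i → i) m n) (cong (upTo m ++_) (sym (map-upTo (m +_) n)))

record SpanningPath (R : Rel ℕ ℓ) (n e : ℕ) : Set ℓ where
  constructor spanning
  field
    {tour} : List ℕ
    covers : 0 ∷ tour ↭ upTo n
    path   : Path R 0 e tour

spanning-mono : ∀ {R : Rel ℕ ℓ} {S : Rel ℕ ℓ′} {n e} → R ⇒ S → SpanningPath R n e → SpanningPath S n e
spanning-mono R⇒S (spanning covers path) = spanning covers (path-mono R⇒S path)

-- A path from 0 to e′ through {0, …, k-1} that makes a detour through a copy, translated by k,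
-- of a path from 0 to e: first front, then the copy from k to k + e, then back.
record Extender (R : Rel ℕ ℓ) (k e e′ : ℕ) : Set ℓ where
  field
    {exit entry} : ℕ
    {front back} : List ℕ
    front-path  : Path R 0 exit front
    into-copy   : R exit k
    out-of-copy : R (k + e) entry
    back-path   : Path R entry e′ back
    covers      : 0 ∷ front ++ entry ∷ back ↭ upTo k

extend : ∀ {R : Rel ℕ ℓ} {k e e′ n} → (∀ {i j} → R i j → R (k + i) (k + j)) →
         Extender R k e e′ → SpanningPath R n e → SpanningPath R (k + n) e′
extend {R = R} {k} {e} {n = n} translate X (spanning {tour} covers path) =
  spanning covers′ (path-++ front-path (path-++ (into-copy ∷ copy) (out-of-copy ∷ back-path)))
  where
  open Extender X using (front-path; into-copy; out-of-copy; back-path; front; back; entry)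
  copy : Path R k (k + e) (map (k +_) tour)
  copy = subst (λ x → Path R x (k + e) (map (k +_) tour)) (+-identityʳ k)
    (path-map (k +_) translate path)
  covers′ : 0 ∷ front ++ (k ∷ map (k +_) tour) ++ entry ∷ back ↭ upTo (k + n)
  covers′ = begin
    (0 ∷ front) ++ copied ++ entry ∷ back   ↭⟨ ++⁺ˡ (0 ∷ front) (++-comm copied (entry ∷ back)) ⟩
    (0 ∷ front) ++ (entry ∷ back) ++ copied ≡⟨ ++-assoc (0 ∷ front) (entry ∷ back) copied ⟨
    (0 ∷ front ++ entry ∷ back) ++ copied   ↭⟨ ++⁺ (Extender.covers X) copied-covers ⟩
    upTo k ++ map (k +_) (upTo n)           ≡⟨ upTo-+ k n ⟨
    upTo (k + n)                            ∎
    where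
    open PermutationReasoning
    copied : List ℕ
    copied = k ∷ map (k +_) tour
    copied-covers : copied ↭ map (k +_) (upTo n)
    copied-covers = subst (λ x → x ∷ map (k +_) tour ↭ map (k +_) (upTo n)) (+-identityʳ k)
      (↭-map⁺ (k +_) covers)

sort≡⇒↭ : ∀ {xs ys} → sort xs ≡ ys → xs ↭ ys
sort≡⇒↭ {xs} refl = ↭-sym (sort-↭ xs)

TourCertificate : Rel ℕ ℓ → ℕ → ℕ → List ℕ → Set ℓ
TourCertificate R n e tour = sort (0 ∷ tour) ≡ upTo n × Path R 0 e tour

tourCertificate? : ∀ {R : Rel ℕ ℓ} → Decidable₂ R → ∀ n e tour → Dec (TourCertificate R n e tour)
tourCertificate? R? n e tour = ≡-dec _≟_ (sort (0 ∷ tour)) (upTo n) ×-dec path? _≟_ R? 0 e tour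

certified-spanning : ∀ {R : Rel ℕ ℓ} {n e tour} → TourCertificate R n e tour → SpanningPath R n e
certified-spanning (sorted , path) = spanning (sort≡⇒↭ sorted) path

-- Both ends of an edge have opposite parity (|i-j| is odd), so a spanning path from 0 ends at an odd vertex
-- iff n is even; ending at 1 then closes it into a cycle.
endpoint : ℕ → ℕ
endpoint zero          = 1
endpoint (suc zero)    = 2
endpoint (suc (suc n)) = endpoint n

endpoint-even : ∀ m → endpoint (m * 2) ≡ 1
endpoint-even zero    = refl
endpoint-even (suc m) = endpoint-even m

extender₁₂ : Extender Stable 15 1 2
extender₁₂ = record
  { front-path  = from-yes (path? _≟_ stable? 0 12 (11 ∷ 6 ∷ 9 ∷ 8 ∷ 1 ∷ 4 ∷ 7 ∷ 10 ∷ 5 ∷ 12 ∷ []))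
  ; into-copy   = from-yes (stable? 12 15)
  ; out-of-copy = from-yes (stable? 16 13)
  ; back-path   = from-yes (path? _≟_ stable? 13 2 (14 ∷ 3 ∷ 2 ∷ []))
  ; covers      = sort≡⇒↭ refl
  }

extender₂₁ : Extender Stable 15 2 1
extender₂₁ = record
  { front-path  = from-yes (path? _≟_ stable? 0 2 (11 ∷ 6 ∷ 5 ∷ 12 ∷ 9 ∷ 8 ∷ 3 ∷ 14 ∷ 13 ∷ 2 ∷ []))
  ; into-copy   = from-yes (stable? 2 15)
  ; out-of-copy = from-yes (stable? 17 10)
  ; back-path   = from-yes (path? _≟_ stable? 10 1 (7 ∷ 4 ∷ 1 ∷ []))
  ; covers      = sort≡⇒↭ refl
  }

extender : ∀ n → Extender Stable 15 (endpoint n) (endpoint (15 + n))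
extender zero          = extender₁₂
extender (suc zero)    = extender₂₁
extender (suc (suc n)) = extender n

-- seed r is a tour of {0, …, r + 7}; the value [] for r ≥ 15 is never used.
seed : ℕ → List ℕ
seed 0  = 5 ∷ 6 ∷ 3 ∷ 2 ∷ 7 ∷ 4 ∷ 1 ∷ []
seed 1  = 5 ∷ 6 ∷ 3 ∷ 8 ∷ 1 ∷ 4 ∷ 7 ∷ 2 ∷ []
seed 2  = 5 ∷ 6 ∷ 9 ∷ 2 ∷ 3 ∷ 8 ∷ 7 ∷ 4 ∷ 1 ∷ []
seed 3  = 5 ∷ 10 ∷ 7 ∷ 4 ∷ 1 ∷ 8 ∷ 9 ∷ 6 ∷ 3 ∷ 2 ∷ []
seed 4  = 5 ∷ 4 ∷ 11 ∷ 10 ∷ 7 ∷ 2 ∷ 3 ∷ 6 ∷ 9 ∷ 8 ∷ 1 ∷ []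
seed 5  = 5 ∷ 12 ∷ 9 ∷ 8 ∷ 1 ∷ 4 ∷ 7 ∷ 10 ∷ 11 ∷ 6 ∷ 3 ∷ 2 ∷ []
seed 6  = 11 ∷ 6 ∷ 3 ∷ 2 ∷ 13 ∷ 8 ∷ 9 ∷ 12 ∷ 5 ∷ 10 ∷ 7 ∷ 4 ∷ 1 ∷ []
seed 7  = 11 ∷ 6 ∷ 9 ∷ 12 ∷ 5 ∷ 10 ∷ 7 ∷ 4 ∷ 1 ∷ 14 ∷ 3 ∷ 8 ∷ 13 ∷ 2 ∷ []
seed 8  = 11 ∷ 4 ∷ 7 ∷ 10 ∷ 5 ∷ 6 ∷ 9 ∷ 12 ∷ 15 ∷ 2 ∷ 13 ∷ 8 ∷ 3 ∷ 14 ∷ 1 ∷ []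
seed 9  = 11 ∷ 6 ∷ 3 ∷ 8 ∷ 9 ∷ 12 ∷ 15 ∷ 14 ∷ 1 ∷ 4 ∷ 7 ∷ 10 ∷ 5 ∷ 16 ∷ 13 ∷ 2 ∷ []
seed 10 = 11 ∷ 4 ∷ 5 ∷ 16 ∷ 13 ∷ 14 ∷ 7 ∷ 10 ∷ 17 ∷ 12 ∷ 15 ∷ 2 ∷ 3 ∷ 6 ∷ 9 ∷ 8 ∷ 1 ∷ []
seed 11 = 17 ∷ 18 ∷ 11 ∷ 6 ∷ 9 ∷ 12 ∷ 15 ∷ 14 ∷ 1 ∷ 4 ∷ 7 ∷ 10 ∷ 5 ∷ 16 ∷ 13 ∷ 8 ∷ 3 ∷ 2 ∷ []
seed 12 = 5 ∷ 4 ∷ 17 ∷ 18 ∷ 11 ∷ 10 ∷ 7 ∷ 2 ∷ 19 ∷ 16 ∷ 13 ∷ 8 ∷ 3 ∷ 6 ∷ 9 ∷ 12 ∷ 15 ∷ 14 ∷ 1 ∷ []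
seed 13 = 17 ∷ 18 ∷ 11 ∷ 16 ∷ 13 ∷ 14 ∷ 15 ∷ 20 ∷ 1 ∷ 4 ∷ 7 ∷ 10 ∷ 5 ∷ 12 ∷ 9 ∷ 6 ∷ 3 ∷ 8 ∷ 19 ∷ 2 ∷ []
seed 14 = 5 ∷ 16 ∷ 13 ∷ 8 ∷ 7 ∷ 20 ∷ 19 ∷ 2 ∷ 15 ∷ 12 ∷ 9 ∷ 6 ∷ 3 ∷ 14 ∷ 21 ∷ 18 ∷ 17 ∷ 10 ∷ 11 ∷ 4 ∷ 1 ∷ []
seed _  = []

seed-spanning : ∀ {n} → n < 23 → 8 ≤ n → SpanningPath Stable n (endpoint n)
seed-spanning n<23 8≤n = certified-spanning (from-yes (allUpTo? seed-ok? 23) n<23 8≤n)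
  where
  seed-ok? : ∀ n → Dec (8 ≤ n → TourCertificate Stable n (endpoint n) (seed (n ∸ 8)))
  seed-ok? n = 8 ≤? n →-dec tourCertificate? stable? n (endpoint n) (seed (n ∸ 8))

stable-spanning : ∀ n → 8 ≤ n → SpanningPath Stable n (endpoint n)
stable-spanning = <-rec (λ n → 8 ≤ n → SpanningPath Stable n (endpoint n)) step
  where
  step : ∀ n → (∀ {m} → m < n → 8 ≤ m → SpanningPath Stable m (endpoint m)) →
         8 ≤ n → SpanningPath Stable n (endpoint n)
  step n rec 8≤n with n <? 23
  ... | yes n<23 = seed-spanning n<23 8≤n
  ... | no n≮23  = subst (λ m → SpanningPath Stable m (endpoint m)) (m+[n∸m]≡n 15≤n)
                     (extend stable-translate (extender (n ∸ 15)) (rec (∸-monoʳ-< z<s 15≤n) 8≤n∸15))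
    where
    15≤n : 15 ≤ n
    15≤n = ≤-trans (m≤m+n 15 8) (≮⇒≥ n≮23)
    8≤n∸15 : 8 ≤ n ∸ 15
    8≤n∸15 = ∸-monoˡ-≤ 15 (≮⇒≥ n≮23)

UpToGraph : Rel ℕ 0ℓ → ℕ → Graph
UpToGraph R n = record { V = upTo n ; Adj = R }

spanning⇒hamiltonianPath : ∀ {R : Rel ℕ 0ℓ} {n e} → SpanningPath R n e → HamiltonianPath (UpToGraph R n)
spanning⇒hamiltonianPath (spanning covers path) = _ , covers , path⇒linked path

spanning⇒hamiltonian : ∀ {R : Rel ℕ 0ℓ} {n e} → SpanningPath R n e → R e 0 → Hamiltonian (UpToGraph R n)
spanning⇒hamiltonian (spanning covers path) closing =
  0 , _ , covers , path⇒linked (path-++ path (closing ∷ []))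

smallPath : ℕ → List ℕ
smallPath 1 = 0 ∷ []
smallPath 2 = 0 ∷ 1 ∷ []
smallPath 3 = 0 ∷ 1 ∷ 2 ∷ []
smallPath 4 = 0 ∷ 3 ∷ 2 ∷ 1 ∷ []
smallPath 5 = 0 ∷ 3 ∷ 2 ∷ 1 ∷ 4 ∷ []
smallPath 6 = 0 ∷ 5 ∷ 4 ∷ 1 ∷ 2 ∷ 3 ∷ []
smallPath 7 = 0 ∷ 3 ∷ 6 ∷ 5 ∷ 4 ∷ 1 ∷ 2 ∷ []
smallPath _ = []

small-hamiltonianPath : ∀ {n} → n < 8 → HamiltonianPath (UpToGraph Adjacent n)
small-hamiltonianPath n<8 =
  let sorted , linked = from-yes (allUpTo? small-ok? 8) n<8 in _ , sort≡⇒↭ sorted , linked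
  where
  small-ok? : ∀ n → Dec (sort (smallPath n) ≡ upTo n × Linked Adjacent (smallPath n))
  small-ok? n = ≡-dec _≟_ (sort (smallPath n)) (upTo n) ×-dec linked? adjacent? (smallPath n)

hamiltonian₄ : Hamiltonian (UpToGraph Adjacent 4)
hamiltonian₄ =
  0 , 3 ∷ 2 ∷ 1 ∷ [] , sort≡⇒↭ refl , from-yes (linked? adjacent? (0 ∷ 3 ∷ 2 ∷ 1 ∷ 0 ∷ []))

hamiltonian₆ : Hamiltonian (UpToGraph Adjacent 6)
hamiltonian₆ =
  0 , 5 ∷ 4 ∷ 1 ∷ 2 ∷ 3 ∷ [] , sort≡⇒↭ refl , from-yes (linked? adjacent? (0 ∷ 5 ∷ 4 ∷ 1 ∷ 2 ∷ 3 ∷ 0 ∷ []))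

index-hamiltonianPath : ∀ n → HamiltonianPath (UpToGraph Adjacent n)
index-hamiltonianPath n with n <? 8
... | yes n<8 = small-hamiltonianPath n<8
... | no n≮8  = spanning⇒hamiltonianPath (spanning-mono stable⇒adjacent (stable-spanning n (≮⇒≥ n≮8)))

index-hamiltonian : ∀ m → 2 < 2 * m → Hamiltonian (UpToGraph Adjacent (2 * m))
index-hamiltonian 1 (s≤s (s≤s ()))
index-hamiltonian 2 _ = hamiltonian₄
index-hamiltonian 3 _ = hamiltonian₆
index-hamiltonian m@(suc (suc (suc (suc _)))) _ =
  spanning⇒hamiltonian (subst (SpanningPath Adjacent (2 * m)) ends-at-1 adjacent-spanning)
                       (from-yes (adjacent? 1 0))
  where
  adjacent-spanning : SpanningPath Adjacent (2 * m) (endpoint (2 * m))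
  adjacent-spanning =
    spanning-mono stable⇒adjacent (stable-spanning (2 * m) (*-monoʳ-≤ 2 (s≤s (s≤s (s≤s (s≤s z≤n))))))
  ends-at-1 : endpoint (2 * m) ≡ 1
  ends-at-1 = trans (cong endpoint (*-comm 2 m)) (endpoint-even m)

linked-map : ∀ {P : Pred A ℓ} {R : Rel A ℓ′} {S : Rel B ℓ″} (f : A → B) →
             (∀ {x y} → P x → P y → R x y → S (f x) (f y)) →
             ∀ {xs} → All P xs → Linked R xs → Linked S (map f xs)
linked-map f pres _                 []       = []
linked-map f pres _                 [-]      = [-]
linked-map f pres (px ∷ py ∷ pxs) (r ∷ rs) = pres px py r ∷ linked-map f pres (py ∷ pxs) rs

module _ {g h : Graph} (f : ℕ → ℕ) (f-V : map f (Graph.V g) ↭ Graph.V h)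
         (f-Adj : ∀ {x y} → x ∈ Graph.V g → y ∈ Graph.V g → Graph.Adj g x y → Graph.Adj h (f x) (f y))
         where

  hamiltonianPath-map : HamiltonianPath g → HamiltonianPath h
  hamiltonianPath-map (vs , vs↭V , linked) =
    map f vs , ↭-trans (↭-map⁺ f vs↭V) f-V , linked-map f f-Adj (All.tabulate (∈-resp-↭ vs↭V)) linked

  hamiltonian-map : Hamiltonian g → Hamiltonian h
  hamiltonian-map (v , vs , vs↭V , linked) =
    f v , map f vs , ↭-trans (↭-map⁺ f vs↭V) f-V ,
    subst (Linked (Graph.Adj h)) (cong (f v ∷_) (map-++ f vs [ v ]))
      (linked-map f f-Adj (All-++⁺ in-V (All.head in-V ∷ [])) linked)
    where
    in-V : All (_∈ Graph.V g) (v ∷ vs)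
    in-V = All.tabulate (∈-resp-↭ vs↭V)

vertex : ℕ → ℕ
vertex i = 2 * suc i

vertex-injective : ∀ {i j} → vertex i ≡ vertex j → i ≡ j
vertex-injective {i} {j} = suc-injective ∘ *-cancelˡ-≡ (suc i) (suc j) 2

half-sum-vertex : ∀ i j → (vertex i + vertex j) / 2 ≡ 2 + i + j
half-sum-vertex i j = trans (cong (_/ 2) (double i j)) (m*n/n≡m (2 + i + j) 2)
  where
  open +-*-Solver
  double : ∀ i j → 2 * (1 + i) + 2 * (1 + j) ≡ (2 + i + j) * 2
  double = solve 2 (λ i j → con 2 :* (con 1 :+ i) :+ con 2 :* (con 1 :+ j) := (con 2 :+ i :+ j) :* con 2)
    refl

half-diff-vertex : ∀ i j → ∣ vertex i - vertex j ∣ / 2 ≡ ∣ i - j ∣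
half-diff-vertex i j = begin
  ∣ 2 * suc i - 2 * suc j ∣ / 2 ≡⟨ cong (_/ 2) (*-distribˡ-∣-∣ 2 (suc i) (suc j)) ⟨
  2 * ∣ i - j ∣ / 2             ≡⟨ cong (_/ 2) (*-comm 2 ∣ i - j ∣) ⟩
  ∣ i - j ∣ * 2 / 2             ≡⟨ m*n/n≡m ∣ i - j ∣ 2 ⟩
  ∣ i - j ∣                     ∎
  where open ≡-Reasoning

admissible⇒G-Adj : ∀ p {n i j} → i ∈ upTo n → j ∈ upTo n → Admissible p (2 + i + j) → Admissible p ∣ i - j ∣ →
                   Graph.Adj (G p n) (vertex i) (vertex j)
admissible⇒G-Adj p {i = i} {j} i∈ j∈ sum diff@(_ , diff>0 , _) =
    ∈-map⁺ vertex i∈ , ∈-map⁺ vertex j∈ , distinct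
  , subst (Admissible p) (sym (half-sum-vertex i j)) sum
  , subst (Admissible p) (sym (half-diff-vertex i j)) diff
  where
  distinct : vertex i ≢ vertex j
  distinct = <⇒≢ diff>0 ∘ sym ∘ m≡n⇒∣m-n∣≡0 ∘ vertex-injective

adjacent⇒G35-Adj : ∀ {n i j} → i ∈ upTo n → j ∈ upTo n → Adjacent i j →
                   Graph.Adj (G35 n) (vertex i) (vertex j)
adjacent⇒G35-Adj i∈ j∈ (adjacent (sum₃ , sum₅) (diff₃ , diff₅)) =
  admissible⇒G-Adj 3 i∈ j∈ sum₃ diff₃ , admissible⇒G-Adj 5 i∈ j∈ sum₅ diff₅

theorem6p3 : ((n : ℕ) → HamiltonianPath (G35 n))
           × ((m : ℕ) → 2 < 2 * m → Hamiltonian (G35 (2 * m)))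
theorem6p3 =
    (λ n → hamiltonianPath-map vertex ↭-refl adjacent⇒G35-Adj (index-hamiltonianPath n))
  , (λ m 2<2m → hamiltonian-map vertex ↭-refl adjacent⇒G35-Adj (index-hamiltonian m 2<2m))
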